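{- Let $k\ge 3$ and let $(G,\mathcal{X})$ be a $k$-ordered graph. For any integer $\ell\ge 2$, if $G$ contains a forward path of length $\ell$, then $G$ contains cycles of at least $\log_2(\ell+1)-1$ distinct lengths.
   Context: Let $G$ be a graph on $n$ vertices and $\mathcal{X}=x_1,\dots,x_n$ an ordering of $V(G)$. Write $N^+(x_i)=\{x_j\in N_G(x_i):j>i\}$, $d^+(x_i)=|N^+(x_i)|$ and $d^-(x_i)=|\{x_j\in N_G(x_i):j<i\}|$. The pair $(G,\mathcal{X})$ is a $k$-ordered graph if (1) $x_{n-1}x_n\in E(G)$; (2) $d^+(x_i)\in[2,k]$ for all $1\le i\le n-2$; and (3) $d^-(x_i)\ge 1$ for all $2\le i\le n$. A path $w_1w_2\cdots w_t$ is a forward path if $w_{i+1}\in N^+(w_i)$ for every $i\in[t-1]$. Lengths of paths and cycles are numbers of edges. -}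

module Defs where

open import Data.Nat using (ℕ; zero; suc; _+_; _≤_; _<_)
open import Data.Fin using (Fin; toℕ; fromℕ<)
open import Data.Fin.Properties using () renaming (_<?_ to _<ᶠ?_)
open import Data.Bool using (Bool; true; false)
open import Data.Bool.Properties using () renaming (_≟_ to _≟ᵇ_)
open import Data.List using (List; length; filter; allFin)
open import Data.Product using (Σ; ∃-syntax; _×_)
open import Relation.Binary.PropositionalEquality using (_≡_)
open import Relation.Nullary.Decidable using (_×-dec_)
open import Function.Definitions using (Injective)

-- The ordering 𝒳 = x₁,…,xₙ of V(G)
-- is the natural order of Fin n (x_{i+1} is the vertex with toℕ = i).
record Graph (n : ℕ) : Set where
  field
    adj    : Fin n → Fin n → Bool
    sym    : ∀ i j → adj i j ≡ adj j i
    irrefl : ∀ i → adj i i ≡ false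

open Graph public

E : ∀ {n} → Graph n → Fin n → Fin n → Set
E G i j = adj G i j ≡ true

d⁺ : ∀ {n} → Graph n → Fin n → ℕ
d⁺ {n} G i = length (filter (λ j → (i <ᶠ? j) ×-dec (adj G i j ≟ᵇ true)) (allFin n))

d⁻ : ∀ {n} → Graph n → Fin n → ℕ
d⁻ {n} G i = length (filter (λ j → (j <ᶠ? i) ×-dec (adj G i j ≟ᵇ true)) (allFin n))

-- (G, natural order) is a k-ordered graph (0-indexed version of (1)-(3)).
record KOrdered (k : ℕ) {n : ℕ} (G : Graph n) : Set where
  field
    lastEdge  : ∃[ i ] ∃[ j ] (toℕ i + 2 ≡ n × toℕ j + 1 ≡ n × E G i j)
    fwdDeg    : ∀ (i : Fin n) → toℕ i + 2 < n → 2 ≤ d⁺ G i × d⁺ G i ≤ k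
    bwdDeg    : ∀ (i : Fin n) → 1 ≤ toℕ i → 1 ≤ d⁻ G i

ForwardPath : ∀ {n} → Graph n → ℕ → Set
ForwardPath {n} G ℓ =
  Σ (Fin (suc ℓ) → Fin n) λ w →
    ∀ (t : Fin (suc ℓ)) (h : suc (toℕ t) < suc ℓ) →
      (toℕ (w t) < toℕ (w (fromℕ< h))) × E G (w t) (w (fromℕ< h))

HasCycleOfLength : ∀ {n} → Graph n → ℕ → Set
HasCycleOfLength {n} G L =
  Σ (Fin L → Fin n) λ c →
    3 ≤ L
    × Injective _≡_ _≡_ c
    × (∀ (t : Fin L) (h : suc (toℕ t) < L) → E G (c t) (c (fromℕ< h)))
    × (∀ (s t : Fin L) → toℕ s + 1 ≡ L → toℕ t ≡ 0 → E G (c s) (c t))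

{-# OPTIONS --safe #-}
module Submission where

-- Let the height of a vertex be the length of a longest forward path from it, and let down w be a
-- forward neighbour of w one level lower.  Descending from a vertex v of height g ≥ 2 visits heights
-- g, g-1, …, 0: this is the spine of v.  A spine vertex a of height ≥ 2 has a second forward
-- neighbour b ≠ down a (d⁺ ≥ 2); descending from b until the spine is met gives an ear that rejoins
-- the spine at least two levels below a and has no more vertices than that drop.  Taking the ear at
-- v, then the ear at the spine vertex just above the previous foot, and so on down to height 0, and
-- walking alternately along spine segments and ears, gives a cycle through every spine vertex (so of
-- length > g) to which the ears add fewer than g vertices (so of length ≤ 2g); the ears are pairwise
-- disjoint because they rejoin the spine at different heights.  The first vertex of a forward path
-- of length ℓ has height h ≥ ℓ, and applying this to vertices of height 2, 4, 8, … ≤ h gives cycles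
-- whose lengths lie in the disjoint intervals (2ⁱ, 2ⁱ⁺¹].

open import Defs hiding (sym)
open import Data.Bool using (true)
open import Data.Bool.Properties using () renaming (_≟_ to _≟ᵇ_)
open import Data.Empty using (⊥-elim)
open import Data.Fin using (Fin; toℕ; fromℕ<)
import Data.Fin as Fin
open import Data.Fin.Properties using (toℕ-fromℕ<; toℕ-injective; toℕ<n)
open import Data.List using (List; []; _∷_; _++_; length; lookup; filter; allFin; applyUpTo)
import Data.List as List
open import Data.List.Extrema.Nat using (max; xs≤max; argmax-sel)
open import Data.List.Membership.Propositional using (_∈_)
open import Data.List.Membership.Propositional.Properties
  using (∈-lookup; ∈-filter⁺; ∈-filter⁻; ∈-allFin; ∈-map⁺; ∈-map⁻; ∈-applyUpTo⁻; ∈-++⁻)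
open import Data.List.Properties
  using (length-++; length-reverse; unfold-reverse; map-cong-local; length-applyUpTo)
open import Data.List.Relation.Binary.Disjoint.Propositional using (Disjoint)
open import Data.List.Relation.Binary.Permutation.Propositional using (↭-sym; ↭⇒↭ₛ)
open import Data.List.Relation.Binary.Permutation.Propositional.Properties using (↭-reverse)
import Data.List.Relation.Binary.Permutation.Setoid.Properties as ↭ₛ
open import Data.List.Relation.Unary.All using (All; []; _∷_)
import Data.List.Relation.Unary.All as All
open import Data.List.Relation.Unary.AllPairs using ([]; _∷_)
open import Data.List.Relation.Unary.Any using (here; there)
open import Data.List.Relation.Unary.Any.Properties using (reverse⁻)
open import Data.List.Relation.Unary.Unique.Propositional using (Unique)
open import Data.List.Relation.Unary.Unique.Propositional.Properties
  using (++⁺; filter⁺; allFin⁺; applyUpTo⁺₁)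
open import Data.Nat using (ℕ; zero; suc; _+_; _∸_; _*_; _^_; _≤_; _<_; z≤n; s≤s; s<s⁻¹; _≤?_; _≟_)
open import Data.Nat.GeneralisedArithmetic using (iterate)
open import Data.Nat.Induction using (<-wellFounded)
open import Data.Nat.Properties
open import Data.Nat.Tactic.RingSolver using (solve-∀)
open import Data.Product using (Σ; ∃-syntax; _×_; _,_; proj₁; proj₂)
open import Data.Sum using (_⊎_; inj₁; inj₂)
open import Function using (_∘_; id)
open import Induction.WellFounded using (Acc; acc)
open import Relation.Binary.Definitions using (DecidableEquality; Symmetric)
open import Relation.Binary.PropositionalEquality
open import Relation.Nullary using (¬_; Dec; yes; no)
open import Relation.Nullary.Decidable using (_×-dec_)

lookup-injective : ∀ {A : Set} {xs : List A} → Unique xs → ∀ {i j} → lookup xs i ≡ lookup xs j → i ≡ j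
lookup-injective {xs = _ ∷ _} _        {Fin.zero}  {Fin.zero}  _  = refl
lookup-injective {xs = _ ∷ _} (x≢ ∷ _) {Fin.zero}  {Fin.suc j} eq = ⊥-elim (All.lookup x≢ (∈-lookup j) eq)
lookup-injective {xs = _ ∷ _} (x≢ ∷ _) {Fin.suc i} {Fin.zero}  eq =
  ⊥-elim (All.lookup x≢ (∈-lookup i) (sym eq))
lookup-injective {xs = _ ∷ _} (_ ∷ u)  {Fin.suc i} {Fin.suc j} eq = cong Fin.suc (lookup-injective u eq)

unique-reverse : ∀ {A : Set} {xs : List A} → Unique xs → Unique (List.reverse xs)
unique-reverse {A} {xs} = ↭ₛ.Unique-resp-↭ (setoid A) (↭⇒↭ₛ (↭-sym (↭-reverse xs)))

∃-other-element : ∀ {A : Set} → DecidableEquality A → ∀ {xs : List A} → Unique xs → 2 ≤ length xs →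
                  ∀ c → ∃[ b ] b ∈ xs × b ≢ c
∃-other-element _≟_ {a ∷ b ∷ _} ((a≢b ∷ _) ∷ _) _ c with a ≟ c
... | yes a≡c = b , there (here refl) , λ b≡c → a≢b (trans a≡c (sym b≡c))
... | no  a≢c = a , here refl , a≢c
∃-other-element _ {_ ∷ []} _ (s≤s ()) c

dyadic-distinct : (P : ℕ → Set) (h : ℕ) → (∀ m → 2 ≤ m → m ≤ h → ∃[ L ] P L × m < L × L ≤ m + m) →
                  ∃[ Ls ] Unique Ls × All P Ls × h < 2 ^ (length Ls + 1)
dyadic-distinct P h between = let Ls , unique , ps , _ , h< = go h between in Ls , unique , ps , h<
  where
  go : ∀ h → (∀ m → 2 ≤ m → m ≤ h → ∃[ L ] P L × m < L × L ≤ m + m) →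
       ∃[ Ls ] Unique Ls × All P Ls × All (_≤ 2 ^ (length Ls + 1)) Ls × h < 2 ^ (length Ls + 1)
  go zero    _       = [] , [] , [] , [] , s≤s z≤n
  go (suc h) between with go h (λ m 2≤m m≤h → between m 2≤m (m≤n⇒m≤1+n m≤h))
  ... | Ls , unique , ps , bounded , h<m with m≤n⇒m<n∨m≡n h<m
  ...   | inj₁ 1+h<m = Ls , unique , ps , bounded , 1+h<m
  ...   | inj₂ 1+h≡m =
    L ∷ Ls , All.map (λ L′≤m L≡L′ → <⇒≱ m<L (subst (_≤ m) (sym L≡L′) L′≤m)) bounded ∷ unique , pL ∷ ps ,
    subst (L ≤_) m+m≡2m L≤m+m ∷ All.map (λ L′≤m → ≤-trans L′≤m (m≤m+n m (m + 0))) bounded ,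
    subst (_< 2 * m) (sym 1+h≡m) (subst (m <_) m+m≡2m (m<m+n m (<-≤-trans (s≤s z≤n) 2≤m)))
    where
    m = 2 ^ (length Ls + 1)
    2≤m : 2 ≤ m
    2≤m = ^-monoʳ-≤ 2 (m≤n+m 1 (length Ls))
    m+m≡2m : m + m ≡ 2 * m
    m+m≡2m = cong (m +_) (sym (+-identityʳ m))
    L-spec = between m 2≤m (≤-reflexive (sym 1+h≡m))
    L = proj₁ L-spec
    pL = proj₁ (proj₂ L-spec)
    m<L = proj₁ (proj₂ (proj₂ L-spec))
    L≤m+m = proj₂ (proj₂ (proj₂ L-spec))

module Walks {V : Set} (_~_ : V → V → Set) where

  infixr 5 _∷⟨_⟩_

  data Walk : V → V → Set where
    [_]    : ∀ x → Walk x x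
    _∷⟨_⟩_ : ∀ x {y z} → x ~ y → Walk y z → Walk x z

  vertices : ∀ {x y} → Walk x y → List V
  vertices [ x ]         = x ∷ []
  vertices (x ∷⟨ _ ⟩ p) = x ∷ vertices p

  Simple : ∀ {x y} → Walk x y → Set
  Simple p = Unique (vertices p)

  _++⟨_⟩_ : ∀ {x y u z} → Walk x y → y ~ u → Walk u z → Walk x z
  [ x ]          ++⟨ e ⟩ q = x ∷⟨ e ⟩ q
  (x ∷⟨ e′ ⟩ p) ++⟨ e ⟩ q = x ∷⟨ e′ ⟩ (p ++⟨ e ⟩ q)

  vertices-++ : ∀ {x y u z} (p : Walk x y) (e : y ~ u) (q : Walk u z) →
                vertices (p ++⟨ e ⟩ q) ≡ vertices p ++ vertices q
  vertices-++ [ x ]         e q = refl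
  vertices-++ (x ∷⟨ _ ⟩ p) e q = cong (x ∷_) (vertices-++ p e q)

  ∈-++⟨⟩⁻ : ∀ {x y u z v} (p : Walk x y) (e : y ~ u) (q : Walk u z) →
            v ∈ vertices (p ++⟨ e ⟩ q) → v ∈ vertices p ⊎ v ∈ vertices q
  ∈-++⟨⟩⁻ p e q v∈ = ∈-++⁻ (vertices p) (subst (_ ∈_) (vertices-++ p e q) v∈)

  length-++⟨⟩ : ∀ {x y u z} (p : Walk x y) (e : y ~ u) (q : Walk u z) →
                length (vertices (p ++⟨ e ⟩ q)) ≡ length (vertices p) + length (vertices q)
  length-++⟨⟩ p e q = trans (cong length (vertices-++ p e q)) (length-++ (vertices p))

  simple-++ : ∀ {x y u z} {p : Walk x y} (e : y ~ u) {q : Walk u z} →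
              Simple p → Simple q → Disjoint (vertices p) (vertices q) → Simple (p ++⟨ e ⟩ q)
  simple-++ {p = p} e {q} sp sq disj = subst Unique (sym (vertices-++ p e q)) (++⁺ sp sq disj)

  module _ (sym~ : Symmetric _~_) where

    reverse : ∀ {x y} → Walk x y → Walk y x
    reverse [ x ]         = [ x ]
    reverse (x ∷⟨ e ⟩ p) = reverse p ++⟨ sym~ e ⟩ [ x ]

    vertices-reverse : ∀ {x y} (p : Walk x y) → vertices (reverse p) ≡ List.reverse (vertices p)
    vertices-reverse [ x ]         = refl
    vertices-reverse (x ∷⟨ e ⟩ p) = begin
      vertices (reverse p ++⟨ sym~ e ⟩ [ x ])  ≡⟨ vertices-++ (reverse p) (sym~ e) [ x ] ⟩
      vertices (reverse p) ++ x ∷ []          ≡⟨ cong (_++ x ∷ []) (vertices-reverse p) ⟩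
      List.reverse (vertices p) ++ x ∷ []     ≡⟨ unfold-reverse x (vertices p) ⟨
      List.reverse (x ∷ vertices p)           ∎
      where open ≡-Reasoning

    ∈-reverse⁻ : ∀ {x y v} (p : Walk x y) → v ∈ vertices (reverse p) → v ∈ vertices p
    ∈-reverse⁻ p v∈ = reverse⁻ (subst (_ ∈_) (vertices-reverse p) v∈)

    length-reverse-vertices : ∀ {x y} (p : Walk x y) → length (vertices (reverse p)) ≡ length (vertices p)
    length-reverse-vertices p = trans (cong length (vertices-reverse p)) (length-reverse (vertices p))

    simple-reverse : ∀ {x y} {p : Walk x y} → Simple p → Simple (reverse p)
    simple-reverse {p = p} sp = subst Unique (sym (vertices-reverse p)) (unique-reverse sp)

  lookup-head : ∀ {x y} (p : Walk x y) (t : Fin (length (vertices p))) → toℕ t ≡ 0 →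
                lookup (vertices p) t ≡ x
  lookup-head [ x ]         Fin.zero _ = refl
  lookup-head (x ∷⟨ _ ⟩ p) Fin.zero _ = refl

  lookup-last : ∀ {x y} (p : Walk x y) (t : Fin (length (vertices p))) →
                toℕ t + 1 ≡ length (vertices p) → lookup (vertices p) t ≡ y
  lookup-last [ x ]                     Fin.zero    _  = refl
  lookup-last (x ∷⟨ _ ⟩ p)             (Fin.suc t) eq = lookup-last p t (suc-injective eq)
  lookup-last (x ∷⟨ _ ⟩ [ _ ])         Fin.zero    ()
  lookup-last (x ∷⟨ _ ⟩ (_ ∷⟨ _ ⟩ _)) Fin.zero    ()

  lookup-consecutive : ∀ {x y} (p : Walk x y) (t : Fin (length (vertices p)))
                       (h : suc (toℕ t) < length (vertices p)) →
                       lookup (vertices p) t ~ lookup (vertices p) (fromℕ< h)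
  lookup-consecutive [ x ]         Fin.zero    (s≤s ())
  lookup-consecutive (x ∷⟨ e ⟩ p) Fin.zero    h = subst (x ~_) (sym (lookup-head p _ (toℕ-fromℕ< _))) e
  lookup-consecutive (x ∷⟨ e ⟩ p) (Fin.suc t) h = lookup-consecutive p t (s<s⁻¹ h)

module _ {n : ℕ} (G : Graph n) where

  open Walks (E G)

  E-sym : Symmetric (E G)
  E-sym {x} {y} e = trans (Graph.sym G y x) e

  closedWalk⇒cycle : ∀ {x y} (p : Walk x y) → Simple p → E G y x → 3 ≤ length (vertices p) →
                     HasCycleOfLength G (length (vertices p))
  closedWalk⇒cycle p simple yx 3≤len =
    lookup (vertices p) , 3≤len , lookup-injective simple , lookup-consecutive p ,
    λ s t s-last t-first → subst₂ (E G) (sym (lookup-last p s s-last)) (sym (lookup-head p t t-first)) yx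

module Height {n : ℕ} {_⇒_ : Fin n → Fin n → Set} (_⇒?_ : ∀ i j → Dec (i ⇒ j))
              (⇒-increasing : ∀ {i j} → i ⇒ j → toℕ i < toℕ j) where

  successors : Fin n → List (Fin n)
  successors i = filter (i ⇒?_) (allFin n)

  ∈-successors⁺ : ∀ {i j} → i ⇒ j → j ∈ successors i
  ∈-successors⁺ {i} {j} i⇒j = ∈-filter⁺ (i ⇒?_) (∈-allFin j) i⇒j

  ∈-successors⁻ : ∀ {i j} → j ∈ successors i → i ⇒ j
  ∈-successors⁻ {i} j∈ = proj₂ (∈-filter⁻ (i ⇒?_) {xs = allFin n} j∈)

  heightWithin : ℕ → Fin n → ℕ
  heightWithin zero    i = 0
  heightWithin (suc f) i = max 0 (List.map (suc ∘ heightWithin f) (successors i))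

  heightWithin-stable : ∀ f f′ i → n ∸ toℕ i ≤ f → n ∸ toℕ i ≤ f′ → heightWithin f i ≡ heightWithin f′ i
  heightWithin-stable zero    _        i ≤f _   = ⊥-elim (<⇒≱ (m<n⇒0<n∸m (toℕ<n i)) ≤f)
  heightWithin-stable (suc _) zero     i _  ≤f′ = ⊥-elim (<⇒≱ (m<n⇒0<n∸m (toℕ<n i)) ≤f′)
  heightWithin-stable (suc f) (suc f′) i ≤f ≤f′ =
    cong (max 0) (map-cong-local (All.tabulate λ {j} j∈ →
      let j-closer = ∸-monoʳ-< (⇒-increasing (∈-successors⁻ j∈)) (<⇒≤ (toℕ<n j))
      in cong suc (heightWithin-stable f f′ j (≤-pred (≤-trans j-closer ≤f))
                                              (≤-pred (≤-trans j-closer ≤f′)))))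

  height : Fin n → ℕ
  height = heightWithin n

  height-unfold : ∀ i → height i ≡ max 0 (List.map (suc ∘ height) (successors i))
  height-unfold i =
    heightWithin-stable n (suc n) i (m∸n≤m n (toℕ i)) (≤-trans (m∸n≤m n (toℕ i)) (n≤1+n n))

  height-decreasing : ∀ {i j} → i ⇒ j → height j < height i
  height-decreasing {i} i⇒j = subst (_ ≤_) (sym (height-unfold i))
    (All.lookup (xs≤max 0 _) (∈-map⁺ (suc ∘ height) (∈-successors⁺ i⇒j)))

  height-step : ∀ i → 1 ≤ height i → ∃[ j ] i ⇒ j × suc (height j) ≡ height i
  height-step i 1≤h with argmax-sel id 0 (List.map (suc ∘ height) (successors i))
  ... | inj₁ max≡0 = ⊥-elim (<⇒≢ 1≤h (sym (trans (height-unfold i) max≡0)))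
  ... | inj₂ max∈ with ∈-map⁻ (suc ∘ height) max∈
  ...   | j , j∈ , max≡ = j , ∈-successors⁻ j∈ , sym (trans (height-unfold i) max≡)

module KOrderedGraph {k n : ℕ} (G : Graph n) (KO : KOrdered k G) where

  open Walks (E G)
  open KOrdered KO

  V : Set
  V = Fin n

  -- Stated with Fin's _<?_ so that successors i is literally the list whose length is d⁺ G i.
  Forward : V → V → Set
  Forward i j = i Fin.< j × E G i j

  forward? : ∀ i j → Dec (Forward i j)
  forward? i j = (i Fin.<? j) ×-dec (adj G i j ≟ᵇ true)

  open Height forward? proj₁ public

  CycleBetween : ℕ → Set
  CycleBetween m = ∃[ L ] HasCycleOfLength G L × m < L × L ≤ m + m

  ∃-forward-avoiding : ∀ i → toℕ i + 2 < n → ∀ c → ∃[ b ] Forward i b × b ≢ c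
  ∃-forward-avoiding i i+2<n c =
    let b , b∈ , b≢c = ∃-other-element Fin._≟_ (filter⁺ (forward? i) (allFin⁺ n))
                                       (proj₁ (fwdDeg i i+2<n)) c
    in b , ∈-successors⁻ b∈ , b≢c

  ∃-forward : ∀ i → toℕ i + 1 < n → ∃[ j ] Forward i j
  ∃-forward i i+1<n with m≤n⇒m<n∨m≡n (subst (_≤ n) (sym (+-suc (toℕ i) 1)) i+1<n)
  ... | inj₁ i+2<n = let j , i⇒j , _ = ∃-forward-avoiding i i+2<n i in j , i⇒j
  ... | inj₂ i+2≡n with lastEdge
  ...   | i′ , j , i′+2≡n , j+1≡n , i′j = j , i<j , subst (λ x → E G x j) i′≡i i′j
    where
    i′≡i : i′ ≡ i
    i′≡i = toℕ-injective (+-cancelʳ-≡ 2 (toℕ i′) (toℕ i) (trans i′+2≡n (sym i+2≡n)))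
    i<j : toℕ i < toℕ j
    i<j = ≤-reflexive (sym (+-cancelʳ-≡ 1 (toℕ j) (suc (toℕ i))
                              (trans j+1≡n (trans (sym i+2≡n) (+-suc (toℕ i) 1)))))

  height≡0⇒last : ∀ {u} → height u ≡ 0 → toℕ u + 1 ≡ n
  height≡0⇒last {u} h≡0 with m≤n⇒m<n∨m≡n (subst (_≤ n) (+-comm 1 (toℕ u)) (toℕ<n u))
  ... | inj₁ u+1<n = let j , u⇒j = ∃-forward u u+1<n
                     in ⊥-elim (n≮0 (subst (height j <_) h≡0 (height-decreasing u⇒j)))
  ... | inj₂ u+1≡n = u+1≡n

  height≡0-unique : ∀ {u w} → height u ≡ 0 → height w ≡ 0 → u ≡ w
  height≡0-unique hu hw =
    toℕ-injective (+-cancelʳ-≡ 1 _ _ (trans (height≡0⇒last hu) (sym (height≡0⇒last hw))))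

  -- Junk value i when height i ≡ 0.
  down : V → V
  down i with 1 ≤? height i
  ... | yes 1≤h = proj₁ (height-step i 1≤h)
  ... | no  _   = i

  down-spec : ∀ {i} → 1 ≤ height i → Forward i (down i) × suc (height (down i)) ≡ height i
  down-spec {i} 1≤h with 1 ≤? height i
  ... | yes 1≤h′ = proj₂ (height-step i 1≤h′)
  ... | no  1≰h  = ⊥-elim (1≰h 1≤h)

  down-forward : ∀ {i} → 1 ≤ height i → Forward i (down i)
  down-forward = proj₁ ∘ down-spec

  height-down : ∀ {i} → 1 ≤ height i → suc (height (down i)) ≡ height i
  height-down = proj₂ ∘ down-spec

  ≤height-down : ∀ {t i} → suc t ≤ height i → t ≤ height (down i)
  ≤height-down t<h = ≤-pred (subst (_ ≤_) (sym (height-down (≤-trans (s≤s z≤n) t<h))) t<h)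

  ∃-forward-other : ∀ i → 2 ≤ height i → ∀ c → ∃[ b ] Forward i b × b ≢ c
  ∃-forward-other i 2≤h = ∃-forward-avoiding i (subst (_< n) (+-comm 2 (toℕ i)) 2+i<n)
    where
    i⇒j = down-forward (≤-trans (s≤s z≤n) 2≤h)
    j⇒j′ = down-forward (≤height-down 2≤h)
    2+i<n : 2 + toℕ i < n
    2+i<n = ≤-trans (s≤s (≤-trans (s≤s (proj₁ i⇒j)) (proj₁ j⇒j′))) (toℕ<n (down (down i)))

  descend : V → ℕ → V
  descend = iterate down

  descend-+ : ∀ w s t → descend w (s + t) ≡ descend (descend w s) t
  descend-+ w zero    t = refl
  descend-+ w (suc s) t = descend-+ (down w) s t

  height-descend : ∀ w t → t ≤ height w → height (descend w t) ≡ height w ∸ t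
  height-descend w zero    _   = refl
  height-descend w (suc t) t<h = trans (height-descend (down w) t (≤height-down t<h))
                                       (cong (_∸ suc t) (height-down (≤-trans (s≤s z≤n) t<h)))

  descent : ∀ w t → t ≤ height w → Walk w (descend w t)
  descent w zero    _   = [ w ]
  descent w (suc t) t<h =
    w ∷⟨ proj₂ (down-forward (≤-trans (s≤s z≤n) t<h)) ⟩ descent (down w) t (≤height-down t<h)

  vertices-descent : ∀ w t (t≤h : t ≤ height w) → vertices (descent w t t≤h) ≡ applyUpTo (descend w) (suc t)
  vertices-descent w zero    _   = refl
  vertices-descent w (suc t) t<h = cong (w ∷_) (vertices-descent (down w) t (≤height-down t<h))

  length-descent : ∀ w t (t≤h : t ≤ height w) → length (vertices (descent w t t≤h)) ≡ suc t
  length-descent w t t≤h =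
    trans (cong length (vertices-descent w t t≤h)) (length-applyUpTo (descend w) (suc t))

  ∈-descent⁻ : ∀ {u w t} (t≤h : t ≤ height w) → u ∈ vertices (descent w t t≤h) →
               ∃[ s ] s ≤ t × u ≡ descend w s
  ∈-descent⁻ {w = w} {t} t≤h u∈ =
    let s , s<1+t , u≡ = ∈-applyUpTo⁻ (descend w) (subst (_ ∈_) (vertices-descent w t t≤h) u∈)
    in s , ≤-pred s<1+t , u≡

  height-∈-descent : ∀ {u w t} (t≤h : t ≤ height w) → u ∈ vertices (descent w t t≤h) →
                     height (descend w t) ≤ height u × height u ≤ height w
  height-∈-descent {u} {w} {t} t≤h u∈ =
    let s , s≤t , u≡ = ∈-descent⁻ t≤h u∈
        height-u = trans (cong height u≡) (height-descend w s (≤-trans s≤t t≤h))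
    in subst₂ _≤_ (sym (height-descend w t t≤h)) (sym height-u) (∸-monoʳ-≤ (height w) s≤t) ,
       subst (_≤ height w) (sym height-u) (m∸n≤m (height w) s)

  descent-simple : ∀ w t (t≤h : t ≤ height w) → Simple (descent w t t≤h)
  descent-simple w t t≤h = subst Unique (sym (vertices-descent w t t≤h))
    (applyUpTo⁺₁ (descend w) (suc t) λ {r} {s} r<s s<1+t eq →
      let s≤h = ≤-trans (≤-pred s<1+t) t≤h
      in <⇒≢ (∸-monoʳ-< r<s s≤h)
             (begin
               height w ∸ s          ≡⟨ height-descend w s s≤h ⟨
               height (descend w s)  ≡⟨ cong height eq ⟨
               height (descend w r)  ≡⟨ height-descend w r (≤-trans (<⇒≤ r<s) s≤h) ⟩
               height w ∸ r          ∎))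
    where open ≡-Reasoning

  module Spine (v : V) where

    g : ℕ
    g = height v

    spine : ℕ → V
    spine m = descend v (g ∸ m)

    OnSpine : V → Set
    OnSpine w = spine (height w) ≡ w

    onSpine? : ∀ w → Dec (OnSpine w)
    onSpine? w = spine (height w) Fin.≟ w

    height-spine : ∀ {m} → m ≤ g → height (spine m) ≡ m
    height-spine {m} m≤g = trans (height-descend v (g ∸ m) (m∸n≤m g m)) (m∸[m∸n]≡n m≤g)

    onSpine-root : OnSpine v
    onSpine-root = cong (descend v) (n∸n≡0 g)

    onSpine⇒height≤ : ∀ {w} → OnSpine w → height w ≤ g
    onSpine⇒height≤ {w} on with height w ≤? g
    ... | yes h≤g = h≤g
    ... | no  h≰g = ⊥-elim (h≰g (≤-reflexive (cong height (sym v≡w))))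
      where
      v≡w : v ≡ w
      v≡w = trans (cong (descend v) (sym (m≤n⇒m∸n≡0 (<⇒≤ (≰⇒> h≰g))))) on

    onSpine-injective : ∀ {u w} → OnSpine u → OnSpine w → height u ≡ height w → u ≡ w
    onSpine-injective on-u on-w eq = trans (sym on-u) (trans (cong spine eq) on-w)

    onSpine-descend : ∀ {u} t → OnSpine u → t ≤ height u → OnSpine (descend u t)
    onSpine-descend {u} t on t≤h = begin
      spine (height (descend u t))    ≡⟨ cong spine (height-descend u t t≤h) ⟩
      descend v (g ∸ (h ∸ t))         ≡⟨ cong (descend v) depth ⟩
      descend v ((g ∸ h) + t)         ≡⟨ descend-+ v (g ∸ h) t ⟩
      descend (spine h) t             ≡⟨ cong (λ x → descend x t) on ⟩
      descend u t                     ∎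
      where
      open ≡-Reasoning
      h = height u
      depth : g ∸ (h ∸ t) ≡ (g ∸ h) + t
      depth = begin
        g ∸ (h ∸ t)                ≡⟨ cong (_∸ (h ∸ t)) (m∸n+n≡m (onSpine⇒height≤ on)) ⟨
        (g ∸ h) + h ∸ (h ∸ t)      ≡⟨ +-∸-assoc (g ∸ h) (m∸n≤m h t) ⟩
        (g ∸ h) + (h ∸ (h ∸ t))    ≡⟨ cong ((g ∸ h) +_) (m∸[m∸n]≡n t≤h) ⟩
        (g ∸ h) + t                ∎

    onSpine-down : ∀ {u} → OnSpine u → 1 ≤ height u → OnSpine (down u)
    onSpine-down = onSpine-descend 1

    height≡0⇒onSpine : ∀ {u} → height u ≡ 0 → OnSpine u
    height≡0⇒onSpine h≡0 = height≡0-unique (trans (cong (height ∘ spine) h≡0) (height-spine z≤n)) h≡0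

    ¬onSpine⇒1≤height : ∀ {u} → ¬ OnSpine u → 1 ≤ height u
    ¬onSpine⇒1≤height ¬on = n≢0⇒n>0 (¬on ∘ height≡0⇒onSpine)

    descent-onSpine : ∀ {u w t} (t≤h : t ≤ height w) → OnSpine w → u ∈ vertices (descent w t t≤h) → OnSpine u
    descent-onSpine t≤h on u∈ =
      let s , s≤t , u≡ = ∈-descent⁻ t≤h u∈
      in subst OnSpine (sym u≡) (onSpine-descend s on (≤-trans s≤t t≤h))

    -- The height at which the descent from w first meets the spine; the fuel suffices because
    -- every descent step lowers the height and the vertex of height 0 is on the spine.
    opaque
      joinHeightWithin : ℕ → V → ℕ
      joinHeightWithin zero    w = height w
      joinHeightWithin (suc f) w with onSpine? w
      ... | yes _ = height w
      ... | no  _ = joinHeightWithin f (down w)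

      joinHeight : V → ℕ
      joinHeight w = joinHeightWithin (suc (height w)) w

      joinHeight-onSpine : ∀ {w} → OnSpine w → joinHeight w ≡ height w
      joinHeight-onSpine {w} on with onSpine? w
      ... | yes _   = refl
      ... | no  ¬on = ⊥-elim (¬on on)

      joinHeight-down : ∀ {w} → ¬ OnSpine w → joinHeight w ≡ joinHeight (down w)
      joinHeight-down {w} ¬on with onSpine? w
      ... | yes on = ⊥-elim (¬on on)
      ... | no  _  = cong (λ f → joinHeightWithin f (down w)) (sym (height-down (¬onSpine⇒1≤height ¬on)))

    joinHeight≤height : ∀ w → joinHeight w ≤ height w
    joinHeight≤height w = go w (<-wellFounded (height w))
      where
      go : ∀ w → Acc _<_ (height w) → joinHeight w ≤ height w
      go w (acc rec) with onSpine? w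
      ... | yes on  = ≤-reflexive (joinHeight-onSpine on)
      ... | no  ¬on = begin
        joinHeight w         ≡⟨ joinHeight-down ¬on ⟩
        joinHeight (down w)  ≤⟨ go (down w) (rec down<) ⟩
        height (down w)      <⟨ down< ⟩
        height w             ∎
        where
        open ≤-Reasoning
        down< = ≤-reflexive (height-down (¬onSpine⇒1≤height ¬on))

    joinHeight<height⇒¬onSpine : ∀ {w} → joinHeight w < height w → ¬ OnSpine w
    joinHeight<height⇒¬onSpine jh<h on = <⇒≢ jh<h (joinHeight-onSpine on)

    joinHeight≡height⇒onSpine : ∀ {w} → joinHeight w ≡ height w → OnSpine w
    joinHeight≡height⇒onSpine {w} jh≡h with onSpine? w
    ... | yes on  = on
    ... | no  ¬on = ⊥-elim (<⇒≢ jh<h jh≡h)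
      where
      jh<h : joinHeight w < height w
      jh<h = begin-strict
        joinHeight w         ≡⟨ joinHeight-down ¬on ⟩
        joinHeight (down w)  ≤⟨ joinHeight≤height (down w) ⟩
        height (down w)      <⟨ ≤-reflexive (height-down (¬onSpine⇒1≤height ¬on)) ⟩
        height w             ∎
        where open ≤-Reasoning

    joinHeight-descend : ∀ {w} t → t + joinHeight w ≤ height w → joinHeight (descend w t) ≡ joinHeight w
    joinHeight-descend     zero    _     = refl
    joinHeight-descend {w} (suc t) bound = trans (joinHeight-descend t bound′) (sym (joinHeight-down ¬on))
      where
      ¬on : ¬ OnSpine w
      ¬on = joinHeight<height⇒¬onSpine (≤-trans (s≤s (m≤n+m _ t)) bound)
      bound′ : t + joinHeight (down w) ≤ height (down w)
      bound′ = ≤-pred (subst₂ (λ x y → suc (t + x) ≤ y) (joinHeight-down ¬on)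
                              (sym (height-down (¬onSpine⇒1≤height ¬on))) bound)

    descent-joinHeight : ∀ {u w t} (t≤h : t ≤ height w) → OnSpine w → u ∈ vertices (descent w t t≤h) →
                         joinHeight u ≡ height u
    descent-joinHeight t≤h on u∈ = joinHeight-onSpine (descent-onSpine t≤h on u∈)

    JoinAtLeast : ℕ → List V → Set
    JoinAtLeast r xs = ∀ {u} → u ∈ xs → r ≤ joinHeight u

    record Ear (a : V) : Set where
      field
        tip    : V
        a⇒tip  : Forward a tip
        steps  : ℕ
        steps≤ : steps ≤ height tip

      foot : V
      foot = descend tip steps

      leg : Walk tip foot
      leg = descent tip steps steps≤

      field
        foot-onSpine   : OnSpine foot
        leg-joinHeight : ∀ {u} → u ∈ vertices leg → joinHeight u ≡ height foot
        leg-short      : suc (steps + height foot) ≤ height a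
        foot-low       : 2 + height foot ≤ height a

    ear : ∀ {a} → OnSpine a → 2 ≤ height a → Ear a
    ear {a} on-a 2≤h = record
      { tip = b ; a⇒tip = a⇒b ; steps = steps ; steps≤ = steps≤
      ; foot-onSpine = foot-onSpine ; leg-joinHeight = leg-joinHeight
      ; leg-short = leg-short ; foot-low = foot-low }
      where
      b-spec = ∃-forward-other a 2≤h (down a)
      b = proj₁ b-spec
      a⇒b = proj₁ (proj₂ b-spec)
      jh = joinHeight b
      steps = height b ∸ jh
      steps≤ = m∸n≤m (height b) jh
      foot = descend b steps

      steps+jh : steps + jh ≡ height b
      steps+jh = m∸n+n≡m (joinHeight≤height b)

      height-foot : height foot ≡ jh
      height-foot = trans (height-descend b steps steps≤) (m∸[m∸n]≡n (joinHeight≤height b))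

      joinHeight-along : ∀ s → s ≤ steps → joinHeight (descend b s) ≡ jh
      joinHeight-along s s≤ = joinHeight-descend s (≤-trans (+-monoˡ-≤ jh s≤) (≤-reflexive steps+jh))

      foot-onSpine : OnSpine foot
      foot-onSpine = joinHeight≡height⇒onSpine (trans (joinHeight-along steps ≤-refl) (sym height-foot))

      leg-joinHeight : ∀ {u} → u ∈ vertices (descent b steps steps≤) → joinHeight u ≡ height foot
      leg-joinHeight u∈ = let s , s≤ , u≡ = ∈-descent⁻ steps≤ u∈
                          in trans (cong joinHeight u≡) (trans (joinHeight-along s s≤) (sym height-foot))

      leg-short : suc (steps + height foot) ≤ height a
      leg-short = subst (λ x → suc (steps + x) ≤ height a) (sym height-foot)
                        (subst (λ x → suc x ≤ height a) (sym steps+jh) (height-decreasing a⇒b))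

      -- A foot only one level below a would be b itself, on the spine next to a, i.e. down a.
      b≡down : suc (height foot) ≡ height a → b ≡ down a
      b≡down eq = onSpine-injective (subst OnSpine foot≡b foot-onSpine) (onSpine-down on-a 1≤h) same-height
        where
        1≤h = ≤-trans (s≤s z≤n) 2≤h
        steps≡0 : steps ≡ 0
        steps≡0 = n≤0⇒n≡0 (+-cancelʳ-≤ (height foot) steps 0
                            (≤-pred (subst (suc (steps + height foot) ≤_) (sym eq) leg-short)))
        foot≡b : foot ≡ b
        foot≡b = cong (descend b) steps≡0
        same-height : height b ≡ height (down a)
        same-height = trans (cong height (sym foot≡b)) (suc-injective (trans eq (sym (height-down 1≤h))))

      foot-low : 2 + height foot ≤ height a
      foot-low = ≤∧≢⇒< (≤-trans (s≤s (m≤n+m (height foot) steps)) leg-short) (proj₂ (proj₂ b-spec) ∘ b≡down)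

    extend : ∀ {x y} (p : Walk x y) t → t ≤ height y → Walk x (descend y t)
    extend         p zero    _   = p
    extend {y = y} p (suc t) t<h =
      p ++⟨ proj₂ (down-forward (≤-trans (s≤s z≤n) t<h)) ⟩ descent (down y) t (≤height-down t<h)

    length-extend : ∀ {x y} (p : Walk x y) t (t≤h : t ≤ height y) →
                    length (vertices (extend p t t≤h)) ≡ length (vertices p) + t
    length-extend         p zero    _   = sym (+-identityʳ _)
    length-extend {y = y} p (suc t) t<h =
      trans (length-++⟨⟩ p _ _) (cong (length (vertices p) +_) (length-descent (down y) t _))

    extend-simple : ∀ {x y} {p : Walk x y} t (t≤h : t ≤ height y) → OnSpine y →
                    JoinAtLeast (height y) (vertices p) → Simple p → Simple (extend p t t≤h)
    extend-simple         zero    _   _  _       simple = simple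
    extend-simple {y = y} (suc t) t<h on atLeast simple =
      simple-++ _ simple (descent-simple (down y) t t≤h′) λ (u∈p , u∈d) →
        <⇒≱ (begin-strict
               joinHeight _     ≡⟨ descent-joinHeight t≤h′ (onSpine-down on 1≤h) u∈d ⟩
               height _         ≤⟨ proj₂ (height-∈-descent t≤h′ u∈d) ⟩
               height (down y)  <⟨ ≤-reflexive (height-down 1≤h) ⟩
               height y         ∎)
            (atLeast u∈p)
      where
      open ≤-Reasoning
      1≤h = ≤-trans (s≤s z≤n) t<h
      t≤h′ = ≤height-down t<h

    extend-joinAtLeast : ∀ {x y} {p : Walk x y} t (t≤h : t ≤ height y) → OnSpine y →
                         JoinAtLeast (height y) (vertices p) →
                         JoinAtLeast (height (descend y t)) (vertices (extend p t t≤h))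
    extend-joinAtLeast             zero    _   _  atLeast u∈ = atLeast u∈
    extend-joinAtLeast {y = y} {p} (suc t) t<h on atLeast u∈ with ∈-++⟨⟩⁻ p _ _ u∈
    ... | inj₁ u∈p = ≤-trans (≤-trans (≤-reflexive (height-descend y (suc t) t<h)) (m∸n≤m (height y) (suc t)))
                             (atLeast u∈p)
    ... | inj₂ u∈d = subst (height (descend y (suc t)) ≤_)
                           (sym (descent-joinHeight _ (onSpine-down on (≤-trans (s≤s z≤n) t<h)) u∈d))
                           (proj₁ (height-∈-descent _ u∈d))

    module _ {a y} (p : Walk a y) (ε : Ear a) where

      open Ear ε

      reverseThenEar : Walk y foot
      reverseThenEar = reverse (E-sym G) p ++⟨ proj₂ a⇒tip ⟩ leg

      reverseThenEar-simple : Simple p → JoinAtLeast (suc (height foot)) (vertices p) → Simple reverseThenEar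
      reverseThenEar-simple simple atLeast =
        simple-++ _ (simple-reverse (E-sym G) simple) (descent-simple tip steps steps≤) λ (u∈p , u∈l) →
          <⇒≢ (atLeast (∈-reverse⁻ (E-sym G) p u∈p)) (sym (leg-joinHeight u∈l))

      reverseThenEar-joinAtLeast : JoinAtLeast (suc (height foot)) (vertices p) →
                                   JoinAtLeast (height foot) (vertices reverseThenEar)
      reverseThenEar-joinAtLeast atLeast u∈ with ∈-++⟨⟩⁻ (reverse (E-sym G) p) _ leg u∈
      ... | inj₁ u∈p = <⇒≤ (atLeast (∈-reverse⁻ (E-sym G) p u∈p))
      ... | inj₂ u∈l = ≤-reflexive (sym (leg-joinHeight u∈l))

      length-reverseThenEar : length (vertices reverseThenEar) ≡ length (vertices p) + suc steps
      length-reverseThenEar =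
        trans (length-++⟨⟩ (reverse (E-sym G) p) _ leg)
              (cong₂ _+_ (length-reverse-vertices (E-sym G) p) (length-descent tip steps steps≤))

    -- The spine below bottom is still to be traversed, hence the offsets by height bottom.
    record Zigzag : Set where
      field
        {top bottom}   : V
        walk           : Walk top bottom
        top-onSpine    : OnSpine top
        bottom-onSpine : OnSpine bottom
        simple         : Simple walk
        joinAtLeast    : JoinAtLeast (height bottom) (vertices walk)
        long           : suc g ≤ length (vertices walk) + height bottom
        short          : length (vertices walk) + height bottom + height top ≤ suc (g + g)
        top≤           : height top ≤ suc (height bottom)

    open Zigzag

    Tight : Zigzag → Set
    Tight z = height (top z) ≡ suc (height (bottom z))

    root : Zigzag
    root = record
      { walk = [ v ] ; top-onSpine = onSpine-root ; bottom-onSpine = onSpine-root ; simple = [] ∷ []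
      ; joinAtLeast = λ { (here refl) → ≤-reflexive (sym (joinHeight-onSpine onSpine-root)) }
      ; long = ≤-refl ; short = ≤-refl ; top≤ = n≤1+n g }

    zigzag-bounds : ∀ {L c a t e r} → t + suc r ≡ c → suc (e + r) ≤ a →
                    suc g ≤ L + c → L + c + a ≤ suc (g + g) →
                    suc g ≤ L + t + suc e + r × L + t + suc e + r + suc r ≤ suc (g + g)
    zigzag-bounds {L} {c} {a} {t} {e} {r} refl e+r<a long short =
      ≤-trans long (≤-trans (m≤m+n (L + c) e) (≤-reflexive (sym (regroup₁ L t e r)))) ,
      ≤-trans (≤-reflexive (regroup₂ L t e r)) (≤-trans (+-monoʳ-≤ (L + c) e+r<a) short)
      where
      regroup₁ : ∀ L t e r → L + t + suc e + r ≡ L + (t + suc r) + e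
      regroup₁ = solve-∀
      regroup₂ : ∀ L t e r → L + t + suc e + r + suc r ≡ L + (t + suc r) + suc (e + r)
      regroup₂ = solve-∀

    step : (z : Zigzag) → 2 ≤ height (top z) →
           Σ Zigzag λ z′ → Tight z′ × height (bottom z′) < height (bottom z)
    step z 2≤h = z′ , height-a′ , foot<c
      where
      ε = ear (top-onSpine z) 2≤h
      open Ear ε
      r = height foot
      c = height (bottom z)
      foot<c : r < c
      foot<c = ≤-pred (≤-trans foot-low (top≤ z))
      t = c ∸ suc r
      t≤c : t ≤ c
      t≤c = m∸n≤m c (suc r)
      height-a′ : height (descend (bottom z) t) ≡ suc r
      height-a′ = trans (height-descend (bottom z) t t≤c) (m∸[m∸n]≡n foot<c)
      stretched = extend (walk z) t t≤c
      stretched-joinAtLeast : JoinAtLeast (suc r) (vertices stretched)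
      stretched-joinAtLeast u∈ =
        subst (_≤ _) height-a′ (extend-joinAtLeast t t≤c (bottom-onSpine z) (joinAtLeast z) u∈)
      walk′ = reverseThenEar stretched ε
      length′ : length (vertices walk′) ≡ length (vertices (walk z)) + t + suc steps
      length′ = trans (length-reverseThenEar stretched ε)
                      (cong (_+ suc steps) (length-extend (walk z) t t≤c))
      bounds = zigzag-bounds (m∸n+n≡m foot<c) leg-short (long z) (short z)
      z′ : Zigzag
      z′ = record
        { walk = walk′
        ; top-onSpine = onSpine-descend t (bottom-onSpine z) t≤c
        ; bottom-onSpine = foot-onSpine
        ; simple = reverseThenEar-simple stretched ε
                     (extend-simple t t≤c (bottom-onSpine z) (joinAtLeast z) (simple z)) stretched-joinAtLeast
        ; joinAtLeast = reverseThenEar-joinAtLeast stretched ε stretched-joinAtLeast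
        ; long = subst (λ L → suc g ≤ L + r) (sym length′) (proj₁ bounds)
        ; short = subst₂ (λ L h → L + r + h ≤ suc (g + g)) (sym length′) (sym height-a′) (proj₂ bounds)
        ; top≤ = ≤-reflexive height-a′ }

    close : 2 ≤ g → (z : Zigzag) → Tight z → height (bottom z) ≡ 0 → CycleBetween g
    close 2≤g z tight bottom≡0 =
      len , closedWalk⇒cycle G (walk z) (simple z) bottom→top (≤-trans (s≤s 2≤g) g<len) , g<len , len≤2g
      where
      len = length (vertices (walk z))
      top≡1 : height (top z) ≡ 1
      top≡1 = trans tight (cong suc bottom≡0)
      1≤top = ≤-reflexive (sym top≡1)
      bottom≡down : bottom z ≡ down (top z)
      bottom≡down = onSpine-injective (bottom-onSpine z) (onSpine-down (top-onSpine z) 1≤top)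
                                      (trans bottom≡0 (sym (suc-injective (trans (height-down 1≤top) top≡1))))
      bottom→top : E G (bottom z) (top z)
      bottom→top = subst (λ x → E G x (top z)) (sym bottom≡down) (E-sym G (proj₂ (down-forward 1≤top)))
      g<len : g < len
      g<len = subst (suc g ≤_) (trans (cong (len +_) bottom≡0) (+-identityʳ len)) (long z)
      len≤2g : len ≤ g + g
      len≤2g = ≤-pred (subst (_≤ suc (g + g)) len+0+1≡1+len (short z))
        where
        len+0+1≡1+len : len + height (bottom z) + height (top z) ≡ suc len
        len+0+1≡1+len = begin
          len + height (bottom z) + height (top z)  ≡⟨ cong₂ (λ b t → len + b + t) bottom≡0 top≡1 ⟩
          len + 0 + 1                                ≡⟨ cong (_+ 1) (+-identityʳ len) ⟩
          len + 1                                    ≡⟨ +-comm len 1 ⟩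
          suc len                                    ∎
          where open ≡-Reasoning

    zigzag-close : 2 ≤ g → (z : Zigzag) → Tight z → Acc _<_ (height (bottom z)) → CycleBetween g
    zigzag-close 2≤g z tight (acc rec) with height (bottom z) ≟ 0
    ... | yes bottom≡0 = close 2≤g z tight bottom≡0
    ... | no  bottom≢0 =
      let z′ , tight′ , lower = step z (subst (2 ≤_) (sym tight) (s≤s (n≢0⇒n>0 bottom≢0)))
      in zigzag-close 2≤g z′ tight′ (rec lower)

    cycle-between-root : 2 ≤ g → CycleBetween g
    cycle-between-root 2≤g =
      let z , tight , _ = step root 2≤g in zigzag-close 2≤g z tight (<-wellFounded _)

  cycle-between : ∀ w m → 2 ≤ m → m ≤ height w → CycleBetween m
  cycle-between w m 2≤m m≤h =
    subst CycleBetween height-v (Spine.cycle-between-root v (subst (2 ≤_) (sym height-v) 2≤m))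
    where
    v = descend w (height w ∸ m)
    height-v : height v ≡ m
    height-v = trans (height-descend w (height w ∸ m) (m∸n≤m (height w) m)) (m∸[m∸n]≡n m≤h)

  forwardPath⇒height : ∀ {ℓ} (P : ForwardPath G ℓ) → ℓ ≤ height (proj₁ P Fin.zero)
  forwardPath⇒height {ℓ} (w , forward) = go ℓ Fin.zero refl
    where
    go : ∀ d (t : Fin (suc ℓ)) → toℕ t + d ≡ ℓ → d ≤ height (w t)
    go zero    t _     = z≤n
    go (suc d) t t+d≡ℓ = ≤-trans (s≤s (go d (fromℕ< h) next+d≡ℓ)) (height-decreasing (forward t h))
      where
      t+1+d≡ℓ : suc (toℕ t + d) ≡ ℓ
      t+1+d≡ℓ = trans (sym (+-suc (toℕ t) d)) t+d≡ℓ
      h : suc (toℕ t) < suc ℓ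
      h = s≤s (subst (suc (toℕ t) ≤_) t+1+d≡ℓ (s≤s (m≤m+n (toℕ t) d)))
      next+d≡ℓ : toℕ (fromℕ< h) + d ≡ ℓ
      next+d≡ℓ = trans (cong (_+ d) (toℕ-fromℕ< h)) t+1+d≡ℓ

lemma4p3 : ∀ (k : ℕ) → 3 ≤ k → ∀ {n : ℕ} (G : Graph n) → KOrdered k G →
           ∀ (ℓ : ℕ) → 2 ≤ ℓ → ForwardPath G ℓ →
           ∃[ Ls ] (Unique Ls × All (HasCycleOfLength G) Ls
                    × ℓ + 1 ≤ 2 ^ (length Ls + 1))
lemma4p3 k _ G KO ℓ _ P =
  let open KOrderedGraph G KO
      w₀ = proj₁ P Fin.zero
      Ls , unique , cycles , h<2^ = dyadic-distinct (HasCycleOfLength G) (height w₀) (cycle-between w₀)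
  in Ls , unique , cycles ,
     subst (_≤ 2 ^ (length Ls + 1)) (+-comm 1 ℓ) (≤-<-trans (forwardPath⇒height P) h<2^)
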